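{- Let $G=(V,E)$ be a connected undirected graph on $n$ vertices with vertex expansion $\alpha$, and let $\gamma=\min_{S\subset V,\,0<|S|\le n/2}\{\nu(B(S))/|S|\}$. Then $\gamma\ge\alpha/4$; equivalently, for every $S\subset V$ with $0<|S|\le n/2$, the maximum matching of $B(S)$ has size at least $\alpha|S|/4$.
   Context: For $S\subseteq V$, $\partial S=\{v\in V\setminus S: N(v)\cap S\neq\emptyset\}$, $\alpha(S)=|\partial S|/|S|$, and $\alpha=\min_{S\subset V,\,0<|S|\le n/2}\alpha(S)$. $B(S)$ is the bipartite graph with bipartition $(S,V\setminus S)$ and edge set $\{(u,v)\in E:u\in S,v\in V\setminus S\}$; $\nu(H)$ is the maximum matching size of $H$. -}

module Defs where

open import Data.Nat using (ℕ; zero; suc; _+_; _*_; _≤_; _<_)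
open import Data.Fin using (Fin)
open import Data.Fin.Subset using (Subset; ∣_∣; _∈_; _∉_; ⊤)
open import Data.Product using (Σ; ∃; ∃-syntax; _×_; _,_)
open import Data.List using (List; length; []; _∷_)
open import Data.List.Relation.Unary.All using (All)
open import Relation.Nullary using (¬_)
open import Relation.Binary.PropositionalEquality using (_≡_)
open import Data.Integer using (+_)
open import Data.Rational.Unnormalised using (ℚᵘ; mkℚᵘ; _≃_)
  renaming (_≤_ to _≤q_)

record Graph (n : ℕ) : Set₁ where
  field
    Adj   : Fin n → Fin n → Set
    sym   : ∀ {u v} → Adj u v → Adj v u
    irrefl : ∀ {u} → ¬ Adj u u

open Graph public

data Walk {n : ℕ} (G : Graph n) : Fin n → Fin n → Set where
  here : ∀ {u} → Walk G u u
  step : ∀ {u w v} → Adj G u w → Walk G w v → Walk G u v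

Connected : ∀ {n} → Graph n → Set
Connected G = ∀ u v → Walk G u v

InBoundary : ∀ {n} → Graph n → Subset n → Fin n → Set
InBoundary G S v = v ∉ S × ∃[ u ] (u ∈ S × Adj G v u)

IsBoundarySize : ∀ {n} → Graph n → Subset n → ℕ → Set
IsBoundarySize {n} G S k =
  Σ (Subset n) λ D → (∀ v → (v ∈ D → InBoundary G S v) × (InBoundary G S v → v ∈ D))
                     × ∣ D ∣ ≡ k

Admissible : ∀ {n} → Subset n → Set
Admissible {n} S = 0 < ∣ S ∣ × 2 * ∣ S ∣ ≤ n

-- the rational |∂S| / |S| (for |S| = suc m)
ratio : ℕ → ℕ → ℚᵘ
ratio k zero = mkℚᵘ (+ 0) 0
ratio k (suc m) = mkℚᵘ (+ k) m

IsVertexExpansion : ∀ {n} → Graph n → ℚᵘ → Set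
IsVertexExpansion {n} G a =
  (∃[ S ] ∃[ k ] (Admissible S × IsBoundarySize G S k × a ≃ ratio k ∣ S ∣))
  × (∀ S k → Admissible S → IsBoundarySize G S k → a ≤q ratio k ∣ S ∣)

BEdge : ∀ {n} → Graph n → Subset n → Fin n × Fin n → Set
BEdge G S (u , v) = u ∈ S × v ∉ S × Adj G u v

Disjoint : ∀ {n} → Fin n × Fin n → Fin n × Fin n → Set
Disjoint (u , v) (u' , v') = ¬ u ≡ u' × ¬ v ≡ v'

data PairwiseDisjoint {n : ℕ} : List (Fin n × Fin n) → Set where
  []  : PairwiseDisjoint []
  _∷_ : ∀ {e es} → All (Disjoint e) es → PairwiseDisjoint es → PairwiseDisjoint (e ∷ es)

IsMatching : ∀ {n} → Graph n → Subset n → List (Fin n × Fin n) → Set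
IsMatching G S M = All (BEdge G S) M × PairwiseDisjoint M

IsMaxMatchingSize : ∀ {n} → Graph n → Subset n → ℕ → Set
IsMaxMatchingSize G S k =
  (∃[ M ] (IsMatching G S M × length M ≡ k))
  × (∀ M → IsMatching G S M → length M ≤ k)

module Submission where

-- Let M be a maximum matching of B(S) and U the vertices of S that M leaves unmatched.
-- Every boundary vertex of U is an endpoint of M, since a neighbour of U outside S
-- that is not matched would extend M. Hence |∂U| ≤ 2ν, while |S| ≤ |U| + ν.
-- If |S| ≤ 2ν it suffices that α ≤ 2, which any set of ⌊n/2⌋ vertices witnesses.
-- Otherwise |U| > ν, so U is admissible and α|S| ≤ 2α|U| ≤ 2|∂U| ≤ 4ν.

open import Defs
open import Data.Nat using (ℕ)
open import Data.Fin.Subset using (Subset; ∣_∣)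
open import Data.Integer using (+_)
open import Data.Rational.Unnormalised using (ℚᵘ; _≤_; _*_; mkℚᵘ)
import Data.Nat as N

open import Data.Nat using (zero; suc; z≤n; s≤s; _<_; ⌊_/2⌋; ⌈_/2⌉; >-nonZero)
open import Data.Nat.Properties
  using ( ≤-trans; ≰⇒>; ≤-reflexive; n≤1+n; 1+n≰n; m≤n+m; +-suc; +-identityʳ; +-mono-≤; +-monoʳ-≤
        ; +-cancelʳ-<; *-identityʳ; *-mono-≤; *-monoʳ-≤; *-monoˡ-≤; *-distribˡ-+; *-cancelʳ-≤
        ; m+n∸m≡n; ⌊n/2⌋-mono; ⌊n/2⌋≤⌈n/2⌉; ⌊n/2⌋+⌈n/2⌉≡n; ⌊n/2⌋≤n; module ≤-Reasoning )
open import Data.Nat.Tactic.RingSolver using (solve-∀)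
import Data.Integer as ℤ
import Data.Integer.Properties as ℤP
open import Data.Rational.Unnormalised using (*≤*; _≃_; *≡*)
open import Data.Rational.Unnormalised.Properties using (_≤?_)
open import Data.Bool.Properties using (T-≡)
open import Data.Empty using (⊥-elim)
open import Data.Fin using (Fin)
open import Data.Fin.Properties using (any?; sequence)
open import Data.Fin.Subset using (_∈_; _∉_; _∪_; _∩_; ∁; ⁅_⁆; _⊆_; inside; outside)
  renaming (⊥ to ∅)
open import Data.Fin.Subset.Properties
  using ( _∈?_; x∈p∪q⁺; x∈p∩q⁺; x∈p∩q⁻; x∉p⇒x∈∁p; x∈∁p⇒x∉p; x∈⁅x⁆
        ; p⊆q⇒∣p∣≤∣q∣; ∣⊥∣≡0; ∣⁅x⁆∣≡1; ∣∁p∣≡n∸∣p∣; ∣p∩q∣≤∣p∣ )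
open import Data.List using (List; []; _∷_; length)
open import Data.List.Relation.Unary.All using (All; []; _∷_)
open import Data.Product using (_×_; _,_; proj₁; proj₂)
open import Data.Sum using (inj₁; inj₂)
open import Data.Vec using ([]; _∷_; tabulate)
open import Data.Vec.Properties using (lookup∘tabulate; []=⇒lookup; lookup⇒[]=)
open import Effect.Monad using (RawMonad)
open import Function using (_∘_; case_of_)
open import Function.Bundles using (Equivalence)
open import Relation.Binary.PropositionalEquality as ≡ using (_≡_; refl; subst; subst₂; cong)
open import Relation.Nullary using (¬_; Dec; isYes; yes; no)
open import Relation.Nullary.Decidable using (decidable-stable; ¬?; _×-dec_; toWitness; fromWitness)
open import Relation.Nullary.Decidable.Core using (¬¬-excluded-middle)
open import Relation.Nullary.Negation using (¬¬-Monad; ¬¬-map)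
open import Relation.Unary using (Pred; Decidable)

open ≤-Reasoning

⌈n/2⌉≤1+⌊n/2⌋ : ∀ n → ⌈ n /2⌉ N.≤ suc ⌊ n /2⌋
⌈n/2⌉≤1+⌊n/2⌋ zero          = z≤n
⌈n/2⌉≤1+⌊n/2⌋ (suc zero)    = s≤s z≤n
⌈n/2⌉≤1+⌊n/2⌋ (suc (suc n)) = s≤s (⌈n/2⌉≤1+⌊n/2⌋ n)

2+[n+n]≡2*[1+n] : ∀ n → 2 N.+ (n N.+ n) ≡ 2 N.* (1 N.+ n)
2+[n+n]≡2*[1+n] = solve-∀

⌈n/2⌉≤2*⌊n/2⌋ : ∀ {n} → 2 N.≤ n → ⌈ n /2⌉ N.≤ 2 N.* ⌊ n /2⌋
⌈n/2⌉≤2*⌊n/2⌋ {suc (suc n)} (s≤s (s≤s _)) = begin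
  suc ⌈ n /2⌉                 ≤⟨ s≤s (⌈n/2⌉≤1+⌊n/2⌋ n) ⟩
  2 N.+ ⌊ n /2⌋               ≤⟨ +-monoʳ-≤ 2 (m≤n+m ⌊ n /2⌋ ⌊ n /2⌋) ⟩
  2 N.+ (⌊ n /2⌋ N.+ ⌊ n /2⌋) ≡⟨ 2+[n+n]≡2*[1+n] ⌊ n /2⌋ ⟩
  2 N.* suc ⌊ n /2⌋           ∎

2*⌊n/2⌋≤n : ∀ n → 2 N.* ⌊ n /2⌋ N.≤ n
2*⌊n/2⌋≤n n = begin
  ⌊ n /2⌋ N.+ (⌊ n /2⌋ N.+ 0) ≡⟨ cong (⌊ n /2⌋ N.+_) (+-identityʳ ⌊ n /2⌋) ⟩
  ⌊ n /2⌋ N.+ ⌊ n /2⌋         ≤⟨ +-monoʳ-≤ ⌊ n /2⌋ (⌊n/2⌋≤⌈n/2⌉ n) ⟩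
  ⌊ n /2⌋ N.+ ⌈ n /2⌉         ≡⟨ ⌊n/2⌋+⌈n/2⌉≡n n ⟩
  n                           ∎

n∸⌊n/2⌋≡⌈n/2⌉ : ∀ n → n N.∸ ⌊ n /2⌋ ≡ ⌈ n /2⌉
n∸⌊n/2⌋≡⌈n/2⌉ n = ≡.trans (cong (N._∸ ⌊ n /2⌋) (≡.sym (⌊n/2⌋+⌈n/2⌉≡n n))) (m+n∸m≡n ⌊ n /2⌋ ⌈ n /2⌉)

2*m*2*n≡4*n*m : ∀ m n → 2 N.* m N.* (2 N.* n) ≡ 4 N.* n N.* m
2*m*2*n≡4*n*m = solve-∀

[n+n]*m+[n+n]*m≡4*n*m : ∀ m n → (n N.+ n) N.* m N.+ (n N.+ n) N.* m ≡ 4 N.* n N.* m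
[n+n]*m+[n+n]*m≡4*n*m = solve-∀

2*n*m≡2*m*n : ∀ m n → 2 N.* n N.* m ≡ 2 N.* m N.* n
2*n*m≡2*m*n = solve-∀

a*s≤4νD : ∀ {a s u k ν D} → s N.≤ u N.+ u → a N.* u N.≤ k N.* D → k N.≤ ν N.+ ν →
          a N.* s N.≤ 4 N.* ν N.* D
a*s≤4νD {a} {s} {u} {k} {ν} {D} s≤2u au≤kD k≤2ν = begin
  a N.* s                             ≤⟨ *-monoʳ-≤ a s≤2u ⟩
  a N.* (u N.+ u)                     ≡⟨ *-distribˡ-+ a u u ⟩
  a N.* u N.+ a N.* u                 ≤⟨ +-mono-≤ au≤kD au≤kD ⟩
  k N.* D N.+ k N.* D                 ≤⟨ +-mono-≤ kD≤2νD kD≤2νD ⟩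
  (ν N.+ ν) N.* D N.+ (ν N.+ ν) N.* D ≡⟨ [n+n]*m+[n+n]*m≡4*n*m D ν ⟩
  4 N.* ν N.* D                       ∎
  where kD≤2νD = *-monoˡ-≤ D k≤2ν

m≤n+o⇒2*o<m⇒o<n : ∀ {m n o} → m N.≤ n N.+ o → 2 N.* o < m → o < n
m≤n+o⇒2*o<m⇒o<n {m} {n} {o} m≤n+o 2o<m = +-cancelʳ-< o o n (begin-strict
  o N.+ o          ≡⟨ cong (o N.+_) (+-identityʳ o) ⟨
  o N.+ (o N.+ 0)  <⟨ 2o<m ⟩
  m                ≤⟨ m≤n+o ⟩
  n N.+ o          ∎)

∣p∪q∣≤∣p∣+∣q∣ : ∀ {n} (p q : Subset n) → ∣ p ∪ q ∣ N.≤ ∣ p ∣ N.+ ∣ q ∣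
∣p∪q∣≤∣p∣+∣q∣ []            []            = z≤n
∣p∪q∣≤∣p∣+∣q∣ (inside ∷ p)  (inside ∷ q)  =
  s≤s (≤-trans (∣p∪q∣≤∣p∣+∣q∣ p q) (+-monoʳ-≤ ∣ p ∣ (n≤1+n ∣ q ∣)))
∣p∪q∣≤∣p∣+∣q∣ (inside ∷ p)  (outside ∷ q) = s≤s (∣p∪q∣≤∣p∣+∣q∣ p q)
∣p∪q∣≤∣p∣+∣q∣ (outside ∷ p) (inside ∷ q)  =
  ≤-trans (s≤s (∣p∪q∣≤∣p∣+∣q∣ p q)) (≤-reflexive (≡.sym (+-suc ∣ p ∣ ∣ q ∣)))
∣p∪q∣≤∣p∣+∣q∣ (outside ∷ p) (outside ∷ q) = ∣p∪q∣≤∣p∣+∣q∣ p q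

firsts : ∀ {n} → ℕ → Subset n
firsts zero            = ∅
firsts {zero}  (suc k) = []
firsts {suc n} (suc k) = inside ∷ firsts k

∣firsts∣ : ∀ {n} k → k N.≤ n → ∣ firsts {n} k ∣ ≡ k
∣firsts∣ {n}     zero    _         = ∣⊥∣≡0 n
∣firsts∣ {suc n} (suc k) (s≤s k≤n) = cong suc (∣firsts∣ k k≤n)

module _ {n p} {P : Pred (Fin n) p} (P? : Decidable P) where

  subsetOf : Subset n
  subsetOf = tabulate (isYes ∘ P?)

  ∈subsetOf⁻ : ∀ {x} → x ∈ subsetOf → P x
  ∈subsetOf⁻ {x} x∈ = toWitness {a? = P? x} (Equivalence.from T-≡
    (≡.trans (≡.sym (lookup∘tabulate (isYes ∘ P?) x)) ([]=⇒lookup x∈)))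

  ∈subsetOf⁺ : ∀ {x} → P x → x ∈ subsetOf
  ∈subsetOf⁺ {x} px = lookup⇒[]= x subsetOf
    (≡.trans (lookup∘tabulate (isYes ∘ P?) x) (Equivalence.to T-≡ (fromWitness {a? = P? x} px)))

module _ {a n} {A : Set a} (f : A → Fin n) where

  image : List A → Subset n
  image []       = ∅
  image (x ∷ xs) = ⁅ f x ⁆ ∪ image xs

  ∣image∣≤length : ∀ xs → ∣ image xs ∣ N.≤ length xs
  ∣image∣≤length []       = ≤-reflexive (∣⊥∣≡0 n)
  ∣image∣≤length (x ∷ xs) = begin
    ∣ ⁅ f x ⁆ ∪ image xs ∣         ≤⟨ ∣p∪q∣≤∣p∣+∣q∣ ⁅ f x ⁆ (image xs) ⟩
    ∣ ⁅ f x ⁆ ∣ N.+ ∣ image xs ∣   ≡⟨ cong (N._+ ∣ image xs ∣) (∣⁅x⁆∣≡1 (f x)) ⟩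
    suc ∣ image xs ∣               ≤⟨ s≤s (∣image∣≤length xs) ⟩
    suc (length xs)                ∎

  ∈image-head : ∀ {i} x xs → i ≡ f x → i ∈ image (x ∷ xs)
  ∈image-head x xs refl = x∈p∪q⁺ (inj₁ (x∈⁅x⁆ (f x)))

  ∈image-tail : ∀ {i} x xs → i ∈ image xs → i ∈ image (x ∷ xs)
  ∈image-tail x xs = x∈p∪q⁺ ∘ inj₂

fresh⇒disjoint : ∀ {n} {u v : Fin n} M → u ∉ image proj₁ M → v ∉ image proj₂ M →
                 All (Disjoint (u , v)) M
fresh⇒disjoint []      _   _   = []
fresh⇒disjoint (e ∷ M) u∉ v∉ =
  (u∉ ∘ ∈image-head proj₁ e M , v∉ ∘ ∈image-head proj₂ e M)
  ∷ fresh⇒disjoint M (u∉ ∘ ∈image-tail proj₁ e M) (v∉ ∘ ∈image-tail proj₂ e M)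

≤⇒cross-≤ : ∀ {a b d e} → mkℚᵘ (+ a) d ≤ mkℚᵘ (+ b) e → a N.* suc e N.≤ b N.* suc d
≤⇒cross-≤ {a} {b} {d} {e} (*≤* le) =
  ℤP.drop‿+≤+ (subst₂ ℤ._≤_ (≡.sym (ℤP.pos-* a (suc e))) (≡.sym (ℤP.pos-* b (suc d))) le)

cross-≤⇒*-≤ : ∀ {a s t d} → a N.* s N.≤ t N.* suc d →
              mkℚᵘ (+ a) d * mkℚᵘ (+ s) 0 ≤ mkℚᵘ (+ t) 0
cross-≤⇒*-≤ {a} {s} {t} {d} le = *≤* (subst₂ ℤ._≤_ lhs rhs (ℤ.+≤+ le))
  where
  lhs : + (a N.* s) ≡ (+ a ℤ.* + s) ℤ.* + 1
  lhs = ≡.trans (ℤP.pos-* a s) (≡.sym (ℤP.*-identityʳ _))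
  rhs : + (t N.* suc d) ≡ + t ℤ.* + suc (d N.* 1)
  rhs = ≡.trans (cong (λ m → + (t N.* suc m)) (≡.sym (*-identityʳ d))) (ℤP.pos-* t _)

≤ratio⇒ : ∀ {a d k} s → 0 < s → mkℚᵘ (+ a) d ≤ ratio k s → a N.* s N.≤ k N.* suc d
≤ratio⇒ (suc m) _ = ≤⇒cross-≤

-[1+]≄ratio : ∀ {x d k} s → ¬ (mkℚᵘ ℤ.-[1+ x ] d ≃ ratio k s)
-[1+]≄ratio zero          (*≡* ())
-[1+]≄ratio {d = d} {k} (suc m) (*≡* eq) =
  case ≡.trans eq (≡.sym (ℤP.pos-* k (suc d))) of λ ()

-- a / D ≤ α, cross-multiplied.
ExpansionAtLeast : ∀ {n} → Graph n → ℕ → ℕ → Set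
ExpansionAtLeast {n} G a D =
  ∀ S k → Admissible S → IsBoundarySize G S k → a N.* ∣ S ∣ N.≤ k N.* D

isVertexExpansion⇒expansionAtLeast : ∀ {n} {G : Graph n} {a d} →
  IsVertexExpansion G (mkℚᵘ (+ a) d) → ExpansionAtLeast G a (suc d)
isVertexExpansion⇒expansionAtLeast (_ , α-min) S k S-adm S-size =
  ≤ratio⇒ ∣ S ∣ (proj₁ S-adm) (α-min S k S-adm S-size)

¬¬-decidable : ∀ {n} (G : Graph n) → ¬ ¬ (∀ u v → Dec (Adj G u v))
¬¬-decidable G = sequence ¬¬-Applicative (λ u → sequence ¬¬-Applicative (λ v → ¬¬-excluded-middle))
  where ¬¬-Applicative = RawMonad.rawApplicative ¬¬-Monad

module _ {n} (G : Graph n) (adj? : ∀ u v → Dec (Adj G u v)) where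

  inBoundary? : ∀ S → Decidable (InBoundary G S)
  inBoundary? S v = ¬? (v ∈? S) ×-dec any? (λ u → u ∈? S ×-dec adj? v u)

  boundary : Subset n → Subset n
  boundary S = subsetOf (inBoundary? S)

  boundary-isBoundarySize : ∀ S → IsBoundarySize G S ∣ boundary S ∣
  boundary-isBoundarySize S =
    boundary S , (λ v → ∈subsetOf⁻ (inBoundary? S) , ∈subsetOf⁺ (inBoundary? S)) , refl

  ∣boundary∣≤∣∁∣ : ∀ S → ∣ boundary S ∣ N.≤ ∣ ∁ S ∣
  ∣boundary∣≤∣∁∣ S = p⊆q⇒∣p∣≤∣q∣ (x∉p⇒x∈∁p ∘ proj₁ ∘ ∈subsetOf⁻ (inBoundary? S))

  expansion≤2 : ∀ {a D} → ExpansionAtLeast G a D → 2 N.≤ n → a N.≤ 2 N.* D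
  expansion≤2 {a} {D} expand 2≤n = *-cancelʳ-≤ a (2 N.* D) h {{>-nonZero 0<h}} (begin
    a N.* h              ≡⟨ cong (a N.*_) ∣X∣≡h ⟨
    a N.* ∣ X ∣          ≤⟨ expand X _ X-admissible (boundary-isBoundarySize X) ⟩
    ∣ boundary X ∣ N.* D ≤⟨ *-monoˡ-≤ D ∣∂X∣≤2h ⟩
    2 N.* h N.* D        ≡⟨ 2*n*m≡2*m*n D h ⟩
    2 N.* D N.* h        ∎)
    where
    h = ⌊ n /2⌋
    0<h : 0 < h
    0<h = ⌊n/2⌋-mono 2≤n
    X = firsts {n} h
    ∣X∣≡h : ∣ X ∣ ≡ h
    ∣X∣≡h = ∣firsts∣ h (⌊n/2⌋≤n n)
    X-admissible : Admissible X
    X-admissible = subst (λ s → 0 < s × 2 N.* s N.≤ n) (≡.sym ∣X∣≡h) (0<h , 2*⌊n/2⌋≤n n)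
    ∣∂X∣≤2h : ∣ boundary X ∣ N.≤ 2 N.* h
    ∣∂X∣≤2h = begin
      ∣ boundary X ∣ ≤⟨ ∣boundary∣≤∣∁∣ X ⟩
      ∣ ∁ X ∣        ≡⟨ ∣∁p∣≡n∸∣p∣ X ⟩
      n N.∸ ∣ X ∣    ≡⟨ cong (n N.∸_) ∣X∣≡h ⟩
      n N.∸ h        ≡⟨ n∸⌊n/2⌋≡⌈n/2⌉ n ⟩
      ⌈ n /2⌉        ≤⟨ ⌈n/2⌉≤2*⌊n/2⌋ 2≤n ⟩
      2 N.* h        ∎

  module MaximumMatching {S : Subset n} {M : List (Fin n × Fin n)}
    (M-matching : IsMatching G S M)
    (M-maximum : ∀ M′ → IsMatching G S M′ → length M′ N.≤ length M) where

    L R U : Subset n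
    L = image proj₁ M
    R = image proj₂ M
    U = S ∩ ∁ L

    S⊆U∪L : S ⊆ U ∪ L
    S⊆U∪L {v} v∈S with v ∈? L
    ... | yes v∈L = x∈p∪q⁺ (inj₂ v∈L)
    ... | no  v∉L = x∈p∪q⁺ (inj₁ (x∈p∩q⁺ (v∈S , x∉p⇒x∈∁p v∉L)))

    augment : ∀ {u v} → u ∈ S → u ∉ L → v ∉ S → v ∉ R → Adj G u v →
              IsMatching G S ((u , v) ∷ M)
    augment u∈S u∉L v∉S v∉R u~v =
      (u∈S , v∉S , u~v) ∷ proj₁ M-matching , fresh⇒disjoint M u∉L v∉R ∷ proj₂ M-matching

    ∂U⊆L∪R : boundary U ⊆ L ∪ R
    ∂U⊆L∪R {v} v∈∂U with ∈subsetOf⁻ (inBoundary? U) v∈∂U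
    ... | v∉U , u , u∈U , v~u with x∈p∩q⁻ S (∁ L) u∈U | v ∈? S
    ... | _ , _ | yes v∈S = x∈p∪q⁺ (inj₁ (decidable-stable (v ∈? L)
          λ v∉L → v∉U (x∈p∩q⁺ (v∈S , x∉p⇒x∈∁p v∉L))))
    ... | u∈S , u∈∁L | no v∉S = x∈p∪q⁺ (inj₂ (decidable-stable (v ∈? R)
          λ v∉R → 1+n≰n (M-maximum _ (augment u∈S (x∈∁p⇒x∉p u∈∁L) v∉S v∉R (sym G v~u)))))

    ∣S∣≤∣U∣+ν : ∣ S ∣ N.≤ ∣ U ∣ N.+ length M
    ∣S∣≤∣U∣+ν = begin
      ∣ S ∣             ≤⟨ p⊆q⇒∣p∣≤∣q∣ S⊆U∪L ⟩
      ∣ U ∪ L ∣         ≤⟨ ∣p∪q∣≤∣p∣+∣q∣ U L ⟩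
      ∣ U ∣ N.+ ∣ L ∣   ≤⟨ +-monoʳ-≤ ∣ U ∣ (∣image∣≤length proj₁ M) ⟩
      ∣ U ∣ N.+ length M ∎

    ∣∂U∣≤2ν : ∣ boundary U ∣ N.≤ length M N.+ length M
    ∣∂U∣≤2ν = begin
      ∣ boundary U ∣     ≤⟨ p⊆q⇒∣p∣≤∣q∣ ∂U⊆L∪R ⟩
      ∣ L ∪ R ∣          ≤⟨ ∣p∪q∣≤∣p∣+∣q∣ L R ⟩
      ∣ L ∣ N.+ ∣ R ∣    ≤⟨ +-mono-≤ (∣image∣≤length proj₁ M) (∣image∣≤length proj₂ M) ⟩
      length M N.+ length M ∎

  matching-bound : ∀ {a D S ν} → ExpansionAtLeast G a D → Admissible S → IsMaxMatchingSize G S ν →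
                   a N.* ∣ S ∣ N.≤ 4 N.* ν N.* D
  matching-bound {a} {D} {S} expand (0<s , 2s≤n) ((M , M-matching , refl) , M-maximum)
    with ∣ S ∣ N.≤? 2 N.* length M
  ... | yes s≤2ν = ≤-trans (*-mono-≤ (expansion≤2 {a} expand 2≤n) s≤2ν)
                           (≤-reflexive (2*m*2*n≡4*n*m D (length M)))
    where
    2≤n : 2 N.≤ n
    2≤n = ≤-trans (*-monoʳ-≤ 2 0<s) 2s≤n
  ... | no s≰2ν =
    a*s≤4νD {a} {ν = length M} s≤2u (expand U _ U-admissible (boundary-isBoundarySize U)) ∣∂U∣≤2ν
    where
    open MaximumMatching M-matching M-maximum
    ν<∣U∣ : length M < ∣ U ∣
    ν<∣U∣ = m≤n+o⇒2*o<m⇒o<n ∣S∣≤∣U∣+ν (≰⇒> s≰2ν)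
    U-admissible : Admissible U
    U-admissible = ≤-trans (s≤s z≤n) ν<∣U∣ , ≤-trans (*-monoʳ-≤ 2 (∣p∩q∣≤∣p∣ S (∁ L))) 2s≤n
    s≤2u : ∣ S ∣ N.≤ ∣ U ∣ N.+ ∣ U ∣
    s≤2u = ≤-trans ∣S∣≤∣U∣+ν (+-monoʳ-≤ ∣ U ∣ (≤-trans (n≤1+n _) ν<∣U∣))

  α∣S∣≤4ν : (α : ℚᵘ) → IsVertexExpansion G α → (S : Subset n) → Admissible S →
            (ν : ℕ) → IsMaxMatchingSize G S ν → α * mkℚᵘ (+ ∣ S ∣) 0 ≤ mkℚᵘ (+ (4 N.* ν)) 0
  α∣S∣≤4ν (mkℚᵘ ℤ.-[1+ _ ] _) ((T , _ , _ , _ , α≃) , _) _ _ _ _ = ⊥-elim (-[1+]≄ratio ∣ T ∣ α≃)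
  α∣S∣≤4ν (mkℚᵘ (+ a) _) expansion S S-adm _ maxMatching =
    cross-≤⇒*-≤ {a} {∣ S ∣}
      (matching-bound {a} (isVertexExpansion⇒expansionAtLeast {G = G} expansion) S-adm maxMatching)

-- Adjacency is not assumed decidable, but the goal is a decidable inequality, so it may be
-- proved under a double negation, inside which the finitely many adjacencies are decidable.
lemma3 : ∀ {n} (G : Graph n) → Connected G → (α : ℚᵘ) → IsVertexExpansion G α →
         (S : Subset n) → Admissible S → (ν : ℕ) → IsMaxMatchingSize G S ν →
         α * mkℚᵘ (+ ∣ S ∣) 0 ≤ mkℚᵘ (+ (4 N.* ν)) 0
lemma3 G _ α expansion S S-adm ν maxMatching =
  decidable-stable (_ ≤? _)
    (¬¬-map (λ adj? → α∣S∣≤4ν G adj? α expansion S S-adm ν maxMatching) (¬¬-decidable G))
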